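{- Let $g:2^{[n]}\to\mathbb{R}_{\ge0}$ be a coverage function, let $D$ be the diagonal $n\times n$ matrix with $D(i,i)=g(\{i\})$, and let $J$ be the $n\times n$ all-ones matrix. Let $p_{g^{(2)}}(z)=\sum_{\{i,j\}\subseteq[n],\,i\ne j}g(\{i,j\})z_iz_j$, so that $\nabla^2p_{g^{(2)}}$ is the symmetric matrix with zero diagonal and $(i,j)$-entry $g(\{i,j\})$ for $i\neq j$. Then $R:=(DJ+JD)-\nabla^2p_{g^{(2)}}\succeq D$.
   Context: A function $g:2^{[n]}\to\mathbb{R}_{\ge0}$ is a coverage function if there are a finite set $U$, subsets $A_1,\dots,A_n\subseteq U$ and a nonnegative measure $w$ on $U$ with $g(T)=w(\bigcup_{i\in T}A_i)$ for all $T\subseteq[n]$. $A\succeq B$ means $A-B$ is positive semidefinite. -}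

module Defs where

open import Level using (Level; _⊔_) renaming (suc to lsuc)
open import Data.Nat using (ℕ; zero; suc)
open import Data.Fin using (Fin; zero; suc; _≟_)
open import Data.Bool using (Bool; true; false; if_then_else_; _∧_; _∨_)
open import Data.Vec using (lookup; tabulate)
open import Data.Fin.Subset using (Subset; ⁅_⁆; _∪_)
open import Data.Product using (Σ; _×_; _,_)
open import Relation.Nullary using (does)
open import Relation.Binary.Core using (Rel)
open import Relation.Binary.Structures using (IsTotalOrder)
open import Algebra.Bundles using (CommutativeRing)

-- An ordered commutative ring (ℝ is an instance): a commutative ring with a
-- total order compatible with addition and with multiplication of
-- nonnegative elements.
record OrderedCommRing c ℓ₁ ℓ₂ : Set (lsuc (c ⊔ ℓ₁ ⊔ ℓ₂)) where
  field
    commutativeRing : CommutativeRing c ℓ₁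
  open CommutativeRing commutativeRing public hiding (zero)
  field
    _≤_          : Rel Carrier ℓ₂
    isTotalOrder : IsTotalOrder _≈_ _≤_
    +-mono-≤     : ∀ {x y} z → x ≤ y → (x + z) ≤ (y + z)
    *-nonneg     : ∀ {x y} → 0# ≤ x → 0# ≤ y → 0# ≤ (x * y)

module _ {c ℓ₁ ℓ₂} (F : OrderedCommRing c ℓ₁ ℓ₂) where
  open OrderedCommRing F using (Carrier; _≈_; _+_; _*_; _-_; 0#; 1#; _≤_)

  Σ[] : ∀ {n} → (Fin n → Carrier) → Carrier
  Σ[] {zero}  f = 0#
  Σ[] {suc n} f = f zero + Σ[] (λ i → f (suc i))

  Matrix : ℕ → Set c
  Matrix n = Fin n → Fin n → Carrier

  _⊕_ : ∀ {n} → Matrix n → Matrix n → Matrix n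
  (M ⊕ N) i j = M i j + N i j

  _⊖_ : ∀ {n} → Matrix n → Matrix n → Matrix n
  (M ⊖ N) i j = M i j - N i j

  _⊗_ : ∀ {n} → Matrix n → Matrix n → Matrix n
  (M ⊗ N) i j = Σ[] (λ k → M i k * N k j)

  quadForm : ∀ {n} → Matrix n → (Fin n → Carrier) → Carrier
  quadForm M x = Σ[] (λ i → Σ[] (λ j → x i * (M i j * x j)))

  PSD : ∀ {n} → Matrix n → Set (c ⊔ ℓ₂)
  PSD M = ∀ x → 0# ≤ quadForm M x

  _⪰_ : ∀ {n} → Matrix n → Matrix n → Set (c ⊔ ℓ₂)
  A ⪰ B = PSD (A ⊖ B)

  anyFin : ∀ {n} → (Fin n → Bool) → Bool
  anyFin {zero}  f = false
  anyFin {suc n} f = f zero ∨ anyFin (λ i → f (suc i))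

  bigUnion : ∀ {n m} → (Fin n → Subset m) → Subset n → Subset m
  bigUnion A T = tabulate (λ u → anyFin (λ i → lookup T i ∧ lookup (A i) u))

  measure : ∀ {m} → (Fin m → Carrier) → Subset m → Carrier
  measure w S = Σ[] (λ u → if lookup S u then w u else 0#)

  IsCoverage : ∀ {n} → (Subset n → Carrier) → Set (c ⊔ ℓ₁ ⊔ ℓ₂)
  IsCoverage {n} g =
    Σ ℕ λ m → Σ (Fin n → Subset m) λ A → Σ (Fin m → Carrier) λ w →
      (∀ u → 0# ≤ w u) × (∀ T → g T ≈ measure w (bigUnion A T))

  module _ {n : ℕ} (g : Subset n → Carrier) where
    Dmat : Matrix n
    Dmat i j = if does (i ≟ j) then g ⁅ i ⁆ else 0#

    Jmat : Matrix n
    Jmat i j = 1#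

    hessP2 : Matrix n
    hessP2 i j = if does (i ≟ j) then 0# else g (⁅ i ⁆ ∪ ⁅ j ⁆)

    Rmat : Matrix n
    Rmat = ((Dmat ⊗ Jmat) ⊕ (Jmat ⊗ Dmat)) ⊖ hessP2

{-# OPTIONS --safe #-}
-- For a coverage function g(T) = w(⋃_{i∈T} A_i), inclusion–exclusion gives
-- g({i}) + g({j}) − g({i,j}) = w(A_i ∩ A_j) for i ≠ j, while the diagonal of
-- R − D is 2 g({i}) − g({i}) = w(A_i ∩ A_i).  So R − D = Σ_u w(u) χ_u χ_uᵀ,
-- where χ_u is the indicator vector of {i : u ∈ A_i}, and its quadratic form
-- Σ_u w(u) (Σ_{i : u ∈ A_i} x_i)² is nonnegative.
module Submission where

open import Defs
open import Data.Nat using (ℕ)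
open import Data.Fin.Subset using (Subset)

open import Algebra.Bundles using (CommutativeMonoid)
open import Data.Bool.Base using (Bool; true; false; if_then_else_; _∧_; _∨_)
open import Data.Bool.Properties using (∧-distribʳ-∨; ∨-identityʳ; ∨-commutativeMonoid)
open import Data.Fin.Base using (Fin; zero; suc; punchIn)
open import Data.Fin.Properties using (_≟_; punchInᵢ≢i)
open import Data.Fin.Subset using (⁅_⁆; _∪_; _∩_; ⊥)
open import Data.Fin.Subset.Properties using (∩-idem)
open import Data.Product.Base using (_,_)
open import Data.Sum.Base using (inj₁; inj₂)
open import Data.Vec.Base using (lookup)
open import Data.Vec.Properties using (lookup∘tabulate; lookup-zipWith)
open import Data.Vec.Relation.Binary.Pointwise.Extensional using (ext; Pointwise-≡⇒≡)
open import Function.Base using (_∘_)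
open import Relation.Binary.PropositionalEquality as ≡ using (_≡_; _≢_; _≗_)
open import Relation.Binary.Structures using (IsTotalOrder)
open import Relation.Nullary.Decidable using (does; yes; no; dec-true; dec-false)

open import Algebra.Properties.CommutativeSemigroup
  (CommutativeMonoid.commutativeSemigroup ∨-commutativeMonoid)
  using () renaming (interchange to ∨-interchange)

if-≟-diag : ∀ {a} {X : Set a} {n} (i : Fin n) (x y : X) →
            (if does (i ≟ i) then x else y) ≡ x
if-≟-diag i x y = ≡.cong (λ b → if b then x else y) (dec-true (i ≟ i) ≡.refl)

if-≟-≢ : ∀ {a} {X : Set a} {n} {i j : Fin n} (x y : X) → i ≢ j →
         (if does (i ≟ j) then x else y) ≡ y
if-≟-≢ {i = i} {j} x y i≢j = ≡.cong (λ b → if b then x else y) (dec-false (i ≟ j) i≢j)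

module _ {c ℓ₁ ℓ₂} (F : OrderedCommRing c ℓ₁ ℓ₂) where
  open ≡.≡-Reasoning

  anyFin-cong : ∀ {n} {f h : Fin n → Bool} → f ≗ h → anyFin F f ≡ anyFin F h
  anyFin-cong {ℕ.zero}  f≗h = ≡.refl
  anyFin-cong {ℕ.suc n} f≗h = ≡.cong₂ _∨_ (f≗h zero) (anyFin-cong (f≗h ∘ suc))

  anyFin-∨ : ∀ {n} (f h : Fin n → Bool) →
             anyFin F (λ k → f k ∨ h k) ≡ anyFin F f ∨ anyFin F h
  anyFin-∨ {ℕ.zero}  f h = ≡.refl
  anyFin-∨ {ℕ.suc n} f h =
    ≡.trans (≡.cong ((f zero ∨ h zero) ∨_) (anyFin-∨ (f ∘ suc) (h ∘ suc)))
            (∨-interchange (f zero) (h zero) _ _)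

  anyFin-⊥ : ∀ {n} (f : Fin n → Bool) → anyFin F (λ k → lookup (⊥ {n}) k ∧ f k) ≡ false
  anyFin-⊥ {ℕ.zero}  f = ≡.refl
  anyFin-⊥ {ℕ.suc n} f = anyFin-⊥ (f ∘ suc)

  anyFin-⁅⁆ : ∀ {n} (i : Fin n) (f : Fin n → Bool) →
              anyFin F (λ k → lookup ⁅ i ⁆ k ∧ f k) ≡ f i
  anyFin-⁅⁆ zero    f = ≡.trans (≡.cong (f zero ∨_) (anyFin-⊥ (f ∘ suc))) (∨-identityʳ (f zero))
  anyFin-⁅⁆ (suc i) f = anyFin-⁅⁆ i (f ∘ suc)

  module _ {n m} (A : Fin n → Subset m) where

    bigUnion-⁅⁆ : ∀ i → bigUnion F A ⁅ i ⁆ ≡ A i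
    bigUnion-⁅⁆ i = Pointwise-≡⇒≡ (ext λ u →
      ≡.trans (lookup∘tabulate _ u) (anyFin-⁅⁆ i (λ k → lookup (A k) u)))

    bigUnion-∪ : ∀ S T → bigUnion F A (S ∪ T) ≡ bigUnion F A S ∪ bigUnion F A T
    bigUnion-∪ S T = Pointwise-≡⇒≡ (ext λ u → begin
      lookup (bigUnion F A (S ∪ T)) u
        ≡⟨ lookup∘tabulate _ u ⟩
      anyFin F (λ i → lookup (S ∪ T) i ∧ lookup (A i) u)
        ≡⟨ anyFin-cong (λ i → ≡.trans (≡.cong (_∧ lookup (A i) u) (lookup-zipWith _∨_ i S T))
                                      (∧-distribʳ-∨ (lookup (A i) u) (lookup S i) (lookup T i))) ⟩
      anyFin F (λ i → (lookup S i ∧ lookup (A i) u) ∨ (lookup T i ∧ lookup (A i) u))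
        ≡⟨ anyFin-∨ (λ i → lookup S i ∧ lookup (A i) u) (λ i → lookup T i ∧ lookup (A i) u) ⟩
      anyFin F (λ i → lookup S i ∧ lookup (A i) u) ∨ anyFin F (λ i → lookup T i ∧ lookup (A i) u)
        ≡⟨ ≡.cong₂ _∨_ (lookup∘tabulate _ u) (lookup∘tabulate _ u) ⟨
      lookup (bigUnion F A S) u ∨ lookup (bigUnion F A T) u
        ≡⟨ lookup-zipWith _∨_ u (bigUnion F A S) (bigUnion F A T) ⟨
      lookup (bigUnion F A S ∪ bigUnion F A T) u ∎)

module _ {c ℓ₁ ℓ₂} (F : OrderedCommRing c ℓ₁ ℓ₂) where
  open OrderedCommRing F
  open IsTotalOrder isTotalOrder using (total)
    renaming (refl to ≤-refl; trans to ≤-trans; ≲-respˡ-≈ to ≤-respˡ-≈; ≲-respʳ-≈ to ≤-respʳ-≈)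
  open import Algebra.Properties.Semiring.Sum semiring
  open import Algebra.Properties.Group +-group using (//-rightDividesʳ; ⁻¹-involutive)
  open import Algebra.Properties.Ring ring using (-‿distribˡ-*; -‿distribʳ-*)
  open import Relation.Binary.Reasoning.Setoid setoid
  open import Algebra.Solver.CommutativeMonoid *-commutativeMonoid
    using (solve; _⊜_) renaming (_⊕_ to _·_)

  x≈y+z⇒x-z≈y : ∀ {x y z} → x ≈ y + z → x - z ≈ y
  x≈y+z⇒x-z≈y {y = y} {z} x≈y+z = trans (+-congʳ x≈y+z) (//-rightDividesʳ z y)

  +-nonneg : ∀ {x y} → 0# ≤ x → 0# ≤ y → 0# ≤ (x + y)
  +-nonneg {x} {y} 0≤x 0≤y = ≤-trans (≤-respʳ-≈ (sym (+-identityˡ y)) 0≤y) (+-mono-≤ y 0≤x)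

  neg-nonneg : ∀ {x} → x ≤ 0# → 0# ≤ (- x)
  neg-nonneg {x} x≤0 =
    ≤-respˡ-≈ (-‿inverseʳ x) (≤-respʳ-≈ (+-identityˡ (- x)) (+-mono-≤ (- x) x≤0))

  square-nonneg : ∀ x → 0# ≤ (x * x)
  square-nonneg x with total 0# x
  ... | inj₁ 0≤x = *-nonneg 0≤x 0≤x
  ... | inj₂ x≤0 = ≤-respʳ-≈ neg*neg (*-nonneg (neg-nonneg x≤0) (neg-nonneg x≤0))
    where
    neg*neg : - x * - x ≈ x * x
    neg*neg = begin
      - x * - x     ≈⟨ -‿distribˡ-* x (- x) ⟨
      - (x * - x)   ≈⟨ -‿cong (-‿distribʳ-* x x) ⟨
      - (- (x * x)) ≈⟨ ⁻¹-involutive (x * x) ⟩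
      x * x         ∎

  Σ[]≡sum : ∀ {n} (f : Fin n → Carrier) → Σ[] F f ≡ sum f
  Σ[]≡sum {ℕ.zero}  f = ≡.refl
  Σ[]≡sum {ℕ.suc n} f = ≡.cong (f zero +_) (Σ[]≡sum (f ∘ suc))

  sum-nonneg : ∀ {n} (f : Fin n → Carrier) → (∀ i → 0# ≤ f i) → 0# ≤ sum f
  sum-nonneg {ℕ.zero}  f 0≤f = ≤-refl
  sum-nonneg {ℕ.suc n} f 0≤f = +-nonneg (0≤f zero) (sum-nonneg (f ∘ suc) (0≤f ∘ suc))

  sum-select : ∀ {n} (i : Fin n) (f : Fin n → Carrier) →
               (∀ k → k ≢ i → f k ≈ 0#) → sum f ≈ f i
  sum-select {ℕ.suc n} i f f≈0 = begin
    sum f                     ≈⟨ sum-remove {i = i} f ⟩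
    f i + sum (f ∘ punchIn i) ≈⟨ +-congˡ (sum-cong-≋ {n} (λ k → f≈0 (punchIn i k) (punchInᵢ≢i i k))) ⟩
    f i + sum {n} (λ _ → 0#)  ≈⟨ +-congˡ (sum-replicate-zero n) ⟩
    f i + 0#                  ≈⟨ +-identityʳ (f i) ⟩
    f i                       ∎

  sum-*-sum : ∀ {m n} (f : Fin m → Carrier) (h : Fin n → Carrier) →
              sum f * sum h ≈ ∑[ i < m ] ∑[ j < n ] (f i * h j)
  sum-*-sum f h = trans (*-distribʳ-sum (sum h) f) (sum-cong-≋ (λ i → *-distribˡ-sum (f i) h))

  quadForm≡sum : ∀ {n} (M : Matrix F n) x →
                 quadForm F M x ≡ ∑[ i < n ] ∑[ j < n ] (x i * (M i j * x j))
  quadForm≡sum M x = ≡.trans (Σ[]≡sum (λ i → Σ[] F (λ j → x i * (M i j * x j))))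
                             (sum-cong-≗ (λ i → Σ[]≡sum (λ j → x i * (M i j * x j))))

  PSD-resp : ∀ {n} {M N : Matrix F n} → (∀ i j → M i j ≈ N i j) → PSD F N → PSD F M
  PSD-resp {M = M} {N} M≈N N⪰0 x = ≤-respʳ-≈ (sym quadForm-M≈N) (N⪰0 x)
    where
    quadForm-M≈N : quadForm F M x ≈ quadForm F N x
    quadForm-M≈N = begin
      quadForm F M x
        ≡⟨ quadForm≡sum M x ⟩
      ∑[ i < _ ] ∑[ j < _ ] (x i * (M i j * x j))
        ≈⟨ sum-cong-≋ (λ i → sum-cong-≋ (λ j → *-congˡ (*-congʳ (M≈N i j)))) ⟩
      ∑[ i < _ ] ∑[ j < _ ] (x i * (N i j * x j))
        ≡⟨ quadForm≡sum N x ⟨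
      quadForm F N x ∎

  gram : ∀ {m n} → (Fin m → Carrier) → (Fin m → Fin n → Carrier) → Matrix F n
  gram {m} w v i j = ∑[ u < m ] (w u * (v u i * v u j))

  module _ {m n} (w : Fin m → Carrier) (v : Fin m → Fin n → Carrier) where

    quadForm-gram : ∀ x → quadForm F (gram w v) x ≈
                    ∑[ u < m ] (w u * (∑[ i < n ] (v u i * x i) * ∑[ i < n ] (v u i * x i)))
    quadForm-gram x = begin
      quadForm F (gram w v) x
        ≡⟨ quadForm≡sum (gram w v) x ⟩
      ∑[ i < n ] ∑[ j < n ] (x i * (gram w v i j * x j))
        ≈⟨ sum-cong-≋ (λ i → sum-cong-≋ (λ j → entry i j)) ⟩
      ∑[ i < n ] ∑[ j < n ] ∑[ u < m ] (w u * (y u i * y u j))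
        ≈⟨ sum-cong-≋ (λ i → ∑-comm (λ j u → w u * (y u i * y u j))) ⟩
      ∑[ i < n ] ∑[ u < m ] ∑[ j < n ] (w u * (y u i * y u j))
        ≈⟨ ∑-comm (λ i u → ∑[ j < n ] (w u * (y u i * y u j))) ⟩
      ∑[ u < m ] ∑[ i < n ] ∑[ j < n ] (w u * (y u i * y u j))
        ≈⟨ sum-cong-≋ (λ u → factor u) ⟩
      ∑[ u < m ] (w u * (sum (y u) * sum (y u))) ∎
      where
      y : Fin m → Fin n → Carrier
      y u i = v u i * x i

      entry : ∀ i j → x i * (gram w v i j * x j) ≈ ∑[ u < m ] (w u * (y u i * y u j))
      entry i j = begin
        x i * (gram w v i j * x j)
          ≈⟨ *-congˡ (*-distribʳ-sum (x j) (λ u → w u * (v u i * v u j))) ⟩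
        x i * ∑[ u < m ] (w u * (v u i * v u j) * x j)
          ≈⟨ *-distribˡ-sum (x i) (λ u → w u * (v u i * v u j) * x j) ⟩
        ∑[ u < m ] (x i * (w u * (v u i * v u j) * x j))
          ≈⟨ sum-cong-≋ (λ u → rearrange (x i) (x j) (w u) (v u i) (v u j)) ⟩
        ∑[ u < m ] (w u * (y u i * y u j)) ∎
        where
        rearrange : ∀ a b c d e → a * (c * (d * e) * b) ≈ c * (d * a * (e * b))
        rearrange = solve 5 (λ a b c d e →
          (a · ((c · (d · e)) · b)) ⊜ (c · ((d · a) · (e · b)))) refl

      factor : ∀ u → ∑[ i < n ] ∑[ j < n ] (w u * (y u i * y u j)) ≈
                     w u * (sum (y u) * sum (y u))
      factor u = begin
        ∑[ i < n ] ∑[ j < n ] (w u * (y u i * y u j))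
          ≈⟨ sum-cong-≋ (λ i → *-distribˡ-sum (w u) (λ j → y u i * y u j)) ⟨
        ∑[ i < n ] (w u * ∑[ j < n ] (y u i * y u j))
          ≈⟨ *-distribˡ-sum (w u) (λ i → ∑[ j < n ] (y u i * y u j)) ⟨
        w u * ∑[ i < n ] ∑[ j < n ] (y u i * y u j)
          ≈⟨ *-congˡ (sum-*-sum (y u) (y u)) ⟨
        w u * (sum (y u) * sum (y u)) ∎

    gram-PSD : (∀ u → 0# ≤ w u) → PSD F (gram w v)
    gram-PSD 0≤w x = ≤-respʳ-≈ (sym (quadForm-gram x))
      (sum-nonneg _ (λ u → *-nonneg (0≤w u) (square-nonneg _)))

  χ : Bool → Carrier
  χ b = if b then 1# else 0#

  if-∨+if-∧ : ∀ a b v → (if a ∨ b then v else 0#) + (if a ∧ b then v else 0#) ≈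
                        (if a then v else 0#) + (if b then v else 0#)
  if-∨+if-∧ true  true  v = refl
  if-∨+if-∧ true  false v = refl
  if-∨+if-∧ false true  v = +-comm v 0#
  if-∨+if-∧ false false v = refl

  if-∧≈*χχ : ∀ a b v → (if a ∧ b then v else 0#) ≈ v * (χ a * χ b)
  if-∧≈*χχ true  true  v = sym (trans (*-congˡ (*-identityˡ 1#)) (*-identityʳ v))
  if-∧≈*χχ true  false v = sym (trans (*-congˡ (zeroʳ 1#)) (zeroʳ v))
  if-∧≈*χχ false b     v = sym (trans (*-congˡ (zeroˡ (χ b))) (zeroʳ v))

  module _ {m} (w : Fin m → Carrier) where

    measure≡sum : ∀ S → measure F w S ≡ ∑[ u < m ] (if lookup S u then w u else 0#)
    measure≡sum S = Σ[]≡sum (λ u → if lookup S u then w u else 0#)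

    measure-∪+∩ : ∀ S T → measure F w (S ∪ T) + measure F w (S ∩ T) ≈
                          measure F w S + measure F w T
    measure-∪+∩ S T = begin
      measure F w (S ∪ T) + measure F w (S ∩ T)
        ≡⟨ ≡.cong₂ _+_ (measure≡sum (S ∪ T)) (measure≡sum (S ∩ T)) ⟩
      ∑[ u < m ] [ S ∪ T ] u + ∑[ u < m ] [ S ∩ T ] u
        ≈⟨ ∑-distrib-+ ([ S ∪ T ]) ([ S ∩ T ]) ⟨
      ∑[ u < m ] ([ S ∪ T ] u + [ S ∩ T ] u)
        ≈⟨ sum-cong-≋ (λ u → trans
             (reflexive (≡.cong₂ (λ a b → (if a then w u else 0#) + (if b then w u else 0#))
                                 (lookup-zipWith _∨_ u S T) (lookup-zipWith _∧_ u S T)))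
             (if-∨+if-∧ (lookup S u) (lookup T u) (w u))) ⟩
      ∑[ u < m ] ([ S ] u + [ T ] u)
        ≈⟨ ∑-distrib-+ ([ S ]) ([ T ]) ⟩
      ∑[ u < m ] [ S ] u + ∑[ u < m ] [ T ] u
        ≡⟨ ≡.cong₂ _+_ (measure≡sum S) (measure≡sum T) ⟨
      measure F w S + measure F w T ∎
      where
      [_] : Subset m → Fin m → Carrier
      [ S ] u = if lookup S u then w u else 0#

    measure-∩ : ∀ S T → measure F w (S ∩ T) ≈ ∑[ u < m ] (w u * (χ (lookup S u) * χ (lookup T u)))
    measure-∩ S T = trans (reflexive (measure≡sum (S ∩ T))) (sum-cong-≋ λ u → trans
      (reflexive (≡.cong (λ b → if b then w u else 0#) (lookup-zipWith _∧_ u S T)))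
      (if-∧≈*χχ (lookup S u) (lookup T u) (w u)))

  module _ {n} (g : Subset n → Carrier) where

    Dmat⊗Jmat : ∀ i j → _⊗_ F (Dmat F g) (Jmat F g) i j ≈ g ⁅ i ⁆
    Dmat⊗Jmat i j = begin
      Σ[] F (λ k → Dmat F g i k * 1#) ≡⟨ Σ[]≡sum (λ k → Dmat F g i k * 1#) ⟩
      ∑[ k < n ] (Dmat F g i k * 1#)  ≈⟨ sum-select i (λ k → Dmat F g i k * 1#) (λ k k≢i →
                                           trans (*-congʳ (reflexive (if-≟-≢ _ _ (k≢i ∘ ≡.sym))))
                                                 (zeroˡ 1#)) ⟩
      Dmat F g i i * 1#               ≈⟨ *-identityʳ (Dmat F g i i) ⟩
      Dmat F g i i                    ≡⟨ if-≟-diag i (g ⁅ i ⁆) 0# ⟩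
      g ⁅ i ⁆                         ∎

    Jmat⊗Dmat : ∀ i j → _⊗_ F (Jmat F g) (Dmat F g) i j ≈ g ⁅ j ⁆
    Jmat⊗Dmat i j = begin
      Σ[] F (λ k → 1# * Dmat F g k j) ≡⟨ Σ[]≡sum (λ k → 1# * Dmat F g k j) ⟩
      ∑[ k < n ] (1# * Dmat F g k j)  ≈⟨ sum-select j (λ k → 1# * Dmat F g k j) (λ k k≢j →
                                           trans (*-congˡ (reflexive (if-≟-≢ _ _ k≢j)))
                                                 (zeroʳ 1#)) ⟩
      1# * Dmat F g j j               ≈⟨ *-identityˡ (Dmat F g j j) ⟩
      Dmat F g j j                    ≡⟨ if-≟-diag j (g ⁅ j ⁆) 0# ⟩
      g ⁅ j ⁆                         ∎

    module _ {m} (A : Fin n → Subset m) (w : Fin m → Carrier)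
             (g≈ : ∀ T → g T ≈ measure F w (bigUnion F A T)) where

      g-⁅⁆ : ∀ i → g ⁅ i ⁆ ≈ measure F w (A i)
      g-⁅⁆ i = trans (g≈ ⁅ i ⁆) (reflexive (≡.cong (measure F w) (bigUnion-⁅⁆ F A i)))

      g-⁅⁆∪⁅⁆ : ∀ i j → g (⁅ i ⁆ ∪ ⁅ j ⁆) ≈ measure F w (A i ∪ A j)
      g-⁅⁆∪⁅⁆ i j = trans (g≈ (⁅ i ⁆ ∪ ⁅ j ⁆)) (reflexive (≡.cong (measure F w)
        (≡.trans (bigUnion-∪ F A ⁅ i ⁆ ⁅ j ⁆) (≡.cong₂ _∪_ (bigUnion-⁅⁆ F A i) (bigUnion-⁅⁆ F A j)))))

      g-⁅⁆+g-⁅⁆ : ∀ i j → g ⁅ i ⁆ + g ⁅ j ⁆ ≈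
                  (measure F w (A i ∩ A j) + Dmat F g i j) + hessP2 F g i j
      -- Abstracting i ≟ j makes Dmat and hessP2 compute to their diagonal or
      -- off-diagonal entries, which is the form each chain ends in.
      g-⁅⁆+g-⁅⁆ i j with i ≟ j
      ... | yes ≡.refl = begin
        g ⁅ i ⁆ + g ⁅ i ⁆
          ≈⟨ +-congʳ (g-⁅⁆ i) ⟩
        measure F w (A i) + g ⁅ i ⁆
          ≡⟨ ≡.cong (λ S → measure F w S + g ⁅ i ⁆) (∩-idem (A i)) ⟨
        measure F w (A i ∩ A i) + g ⁅ i ⁆
          ≈⟨ +-identityʳ _ ⟨
        (measure F w (A i ∩ A i) + g ⁅ i ⁆) + 0# ∎
      ... | no _ = begin
        g ⁅ i ⁆ + g ⁅ j ⁆
          ≈⟨ +-cong (g-⁅⁆ i) (g-⁅⁆ j) ⟩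
        measure F w (A i) + measure F w (A j)
          ≈⟨ measure-∪+∩ w (A i) (A j) ⟨
        measure F w (A i ∪ A j) + measure F w (A i ∩ A j)
          ≈⟨ +-comm _ _ ⟩
        measure F w (A i ∩ A j) + measure F w (A i ∪ A j)
          ≈⟨ +-cong (+-identityʳ _) (g-⁅⁆∪⁅⁆ i j) ⟨
        (measure F w (A i ∩ A j) + 0#) + g (⁅ i ⁆ ∪ ⁅ j ⁆) ∎

      incidence : Fin m → Fin n → Carrier
      incidence u i = χ (lookup (A i) u)

      Rmat-Dmat≈gram : ∀ i j → _⊖_ F (Rmat F g) (Dmat F g) i j ≈ gram w incidence i j
      Rmat-Dmat≈gram i j = begin
        ((DJ + JD) - hessP2 F g i j) - Dmat F g i j
          ≈⟨ x≈y+z⇒x-z≈y (x≈y+z⇒x-z≈y (trans (+-cong (Dmat⊗Jmat i j) (Jmat⊗Dmat i j))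
                                             (g-⁅⁆+g-⁅⁆ i j))) ⟩
        measure F w (A i ∩ A j)
          ≈⟨ measure-∩ w (A i) (A j) ⟩
        gram w incidence i j ∎
        where
        DJ JD : Carrier
        DJ = _⊗_ F (Dmat F g) (Jmat F g) i j
        JD = _⊗_ F (Jmat F g) (Dmat F g) i j

      Rmat⪰Dmat : (∀ u → 0# ≤ w u) → _⪰_ F (Rmat F g) (Dmat F g)
      Rmat⪰Dmat 0≤w = PSD-resp Rmat-Dmat≈gram (gram-PSD w incidence 0≤w)

mainTheorem12 : ∀ {c ℓ₁ ℓ₂} (F : OrderedCommRing c ℓ₁ ℓ₂) (n : ℕ)
                  (g : Subset n → OrderedCommRing.Carrier F) →
                  IsCoverage F g →
                  _⪰_ F (Rmat F g) (Dmat F g)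
mainTheorem12 F n g (m , A , w , 0≤w , g≈) = Rmat⪰Dmat F g A w g≈ 0≤w
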